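{- Let $\mathsf{C}$ be a category and $(T,\mu,\eta)$ a monad on $\mathsf{C}$. Let $S:\mathsf{C}\to\mathsf{C}$ be a functor that lifts to a functor $\overline{S}:\mathcal{K}l(T)\to\mathcal{K}l(T)$, and let $(\overline{S},m,e)$ be a monad on $\mathcal{K}l(T)$. Assume that $\mathcal{K}l(T)$ is $\mathbf{Cppo}$-enriched and that $\overline{S}$ is locally continuous. Then the Kleisli category $\mathcal{K}l(TS)=\mathcal{K}l(\overline{S})$ is $\mathbf{Cppo}$-enriched, where the hom-set from $X$ to $Y$ in $\mathcal{K}l(\overline{S})$ is $Hom_{\mathcal{K}l(T)}(X,\overline{S}Y)$ carrying the order of $\mathcal{K}l(T)$.
   Context: The Kleisli category $\mathcal{K}l(T)$ has the objects of $\mathsf{C}$; a morphism $X\multimap Y$ is a $\mathsf{C}$-morphism $X\to TY$; composition is $g\cdot f=\mu_Z\circ Tg\circ f$ and identities are $\eta_X$. For $f:X\to Y$ in $\mathsf{C}$ put $f^\sharp=\eta_Y\circ f:X\multimap Y$. A functor $S$ on $\mathsf{C}$ lifts to $\overline{S}$ on $\mathcal{K}l(T)$ if $\overline{S}X=SX$ for all objects and $\overline{S}(f^\sharp)=(Sf)^\sharp$ for all $f$ in $\mathsf{C}$. For a monad $(\overline{S},m,e)$ on $\mathcal{K}l(T)$, the Kleisli category $\mathcal{K}l(\overline{S})$ has morphisms $X\multimap \overline{S}Y$ in $\mathcal{K}l(T)$ with composition $g\ast f=m_Z\cdot\overline{S}g\cdot f$ and identities $e_X$; the composite adjunction $\mathsf{C}\rightleftarrows\mathcal{K}l(T)\rightleftarrows\mathcal{K}l(\overline{S})$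 makes $TS$ a monad on $\mathsf{C}$ with $\mathcal{K}l(TS)=\mathcal{K}l(\overline{S})$. A category is $\mathbf{Cppo}$-enriched if every hom-set is a poset with a least element, every ascending $\omega$-chain in a hom-set has a supremum, and composition on either side preserves suprema of ascending $\omega$-chains (it is not required that the least element be absorbing). A functor between $\mathbf{Cppo}$-enriched categories is locally continuous if it preserves suprema of ascending $\omega$-chains on hom-sets. -}

module Defs where

open import Level using (Level; _⊔_) renaming (suc to lsuc)
open import Data.Nat using (ℕ; suc)
open import Data.Product using (Σ; _×_)
open import Relation.Binary.PropositionalEquality
  using (_≡_; refl; sym; trans; cong; cong₂; module ≡-Reasoning)

record Category (o h : Level) : Set (lsuc (o ⊔ h)) where
  infixr 9 _∘_
  field
    Obj : Set o
    _⇒_ : Obj → Obj → Set h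
    id  : ∀ {A} → A ⇒ A
    _∘_ : ∀ {A B C} → B ⇒ C → A ⇒ B → A ⇒ C
    identityˡ : ∀ {A B} {f : A ⇒ B} → id ∘ f ≡ f
    identityʳ : ∀ {A B} {f : A ⇒ B} → f ∘ id ≡ f
    assoc : ∀ {A B C D} {f : A ⇒ B} {g : B ⇒ C} {h : C ⇒ D} →
            (h ∘ g) ∘ f ≡ h ∘ (g ∘ f)

record Endofunctor {o h : Level} (C : Category o h) : Set (o ⊔ h) where
  open Category C
  field
    F₀ : Obj → Obj
    F₁ : ∀ {A B} → A ⇒ B → F₀ A ⇒ F₀ B
    identity : ∀ {A} → F₁ (id {A}) ≡ id
    homomorphism : ∀ {A B C} {f : A ⇒ B} {g : B ⇒ C} → F₁ (g ∘ f) ≡ F₁ g ∘ F₁ f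

record MonadOn {o h : Level} (C : Category o h) (T : Endofunctor C) : Set (o ⊔ h) where
  open Category C
  open Endofunctor T
  field
    η : ∀ X → X ⇒ F₀ X
    μ : ∀ X → F₀ (F₀ X) ⇒ F₀ X
    η-natural : ∀ {X Y} (f : X ⇒ Y) → F₁ f ∘ η X ≡ η Y ∘ f
    μ-natural : ∀ {X Y} (f : X ⇒ Y) → F₁ f ∘ μ X ≡ μ Y ∘ F₁ (F₁ f)
    unitˡ : ∀ {X} → μ X ∘ F₁ (η X) ≡ id
    unitʳ : ∀ {X} → μ X ∘ η (F₀ X) ≡ id
    mult-assoc : ∀ {X} → μ X ∘ F₁ (μ X) ≡ μ X ∘ μ (F₀ X)

module _ {o h : Level} {C : Category o h} {T : Endofunctor C} (M : MonadOn C T) where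
  open Category C
  open Endofunctor T
  open MonadOn M
  open ≡-Reasoning

  private
    _·_ : ∀ {X Y Z} → Y ⇒ F₀ Z → X ⇒ F₀ Y → X ⇒ F₀ Z
    _·_ {Z = Z} g f = μ Z ∘ (F₁ g ∘ f)

    kidˡ : ∀ {X Y} {f : X ⇒ F₀ Y} → η Y · f ≡ f
    kidˡ {Y = Y} {f} = begin
      μ Y ∘ (F₁ (η Y) ∘ f) ≡⟨ sym assoc ⟩
      (μ Y ∘ F₁ (η Y)) ∘ f ≡⟨ cong (_∘ f) unitˡ ⟩
      id ∘ f               ≡⟨ identityˡ ⟩
      f ∎

    kidʳ : ∀ {X Y} {f : X ⇒ F₀ Y} → f · η X ≡ f
    kidʳ {X} {Y} {f} = begin
      μ Y ∘ (F₁ f ∘ η X)       ≡⟨ cong (μ Y ∘_) (η-natural f) ⟩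
      μ Y ∘ (η (F₀ Y) ∘ f)     ≡⟨ sym assoc ⟩
      (μ Y ∘ η (F₀ Y)) ∘ f     ≡⟨ cong (_∘ f) unitʳ ⟩
      id ∘ f                   ≡⟨ identityˡ ⟩
      f ∎

    kassoc : ∀ {A B C' D} {f : A ⇒ F₀ B} {g : B ⇒ F₀ C'} {h : C' ⇒ F₀ D} →
             (h · g) · f ≡ h · (g · f)
    kassoc {A} {B} {C'} {D} {f} {g} {h} = begin
      μ D ∘ (F₁ (μ D ∘ (F₁ h ∘ g)) ∘ f)
        ≡⟨ cong (λ z → μ D ∘ (z ∘ f)) (trans homomorphism (cong (F₁ (μ D) ∘_) homomorphism)) ⟩
      μ D ∘ ((F₁ (μ D) ∘ (F₁ (F₁ h) ∘ F₁ g)) ∘ f)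
        ≡⟨ cong (μ D ∘_) assoc ⟩
      μ D ∘ (F₁ (μ D) ∘ ((F₁ (F₁ h) ∘ F₁ g) ∘ f))
        ≡⟨ sym assoc ⟩
      (μ D ∘ F₁ (μ D)) ∘ ((F₁ (F₁ h) ∘ F₁ g) ∘ f)
        ≡⟨ cong (_∘ ((F₁ (F₁ h) ∘ F₁ g) ∘ f)) mult-assoc ⟩
      (μ D ∘ μ (F₀ D)) ∘ ((F₁ (F₁ h) ∘ F₁ g) ∘ f)
        ≡⟨ assoc ⟩
      μ D ∘ (μ (F₀ D) ∘ ((F₁ (F₁ h) ∘ F₁ g) ∘ f))
        ≡⟨ cong (μ D ∘_) (cong (μ (F₀ D) ∘_) assoc) ⟩
      μ D ∘ (μ (F₀ D) ∘ (F₁ (F₁ h) ∘ (F₁ g ∘ f)))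
        ≡⟨ cong (μ D ∘_) (sym assoc) ⟩
      μ D ∘ ((μ (F₀ D) ∘ F₁ (F₁ h)) ∘ (F₁ g ∘ f))
        ≡⟨ cong (λ z → μ D ∘ (z ∘ (F₁ g ∘ f))) (sym (μ-natural h)) ⟩
      μ D ∘ ((F₁ h ∘ μ C') ∘ (F₁ g ∘ f))
        ≡⟨ cong (μ D ∘_) assoc ⟩
      μ D ∘ (F₁ h ∘ (μ C' ∘ (F₁ g ∘ f))) ∎

  Kleisli : Category o h
  Kleisli = record
    { Obj = Obj
    ; _⇒_ = λ X Y → X ⇒ F₀ Y
    ; id = λ {X} → η X
    ; _∘_ = _·_
    ; identityˡ = kidˡ
    ; identityʳ = kidʳ
    ; assoc = kassoc
    }

-- A lifting of an endofunctor S on C to an endofunctor S̄ on Kl(T):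
-- S̄ X = S X on objects (definitionally, see liftedFunctor) and
-- S̄ (f ♯) = (S f) ♯, where f ♯ = η ∘ f.
record Lifting {o h : Level} {C : Category o h} {T : Endofunctor C}
               (M : MonadOn C T) (S : Endofunctor C) : Set (o ⊔ h) where
  private
    module C = Category C
    module K = Category (Kleisli M)
    module S = Endofunctor S
  open MonadOn M using (η)
  field
    F₁ : ∀ {A B} → A K.⇒ B → S.F₀ A K.⇒ S.F₀ B
    identity : ∀ {A} → F₁ (K.id {A}) ≡ K.id
    homomorphism : ∀ {A B C'} {f : A K.⇒ B} {g : B K.⇒ C'} → F₁ (g K.∘ f) ≡ F₁ g K.∘ F₁ f
    lifts : ∀ {A B} (f : A C.⇒ B) → F₁ (η B C.∘ f) ≡ η (S.F₀ B) C.∘ S.F₁ f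

liftedFunctor : ∀ {o h : Level} {C : Category o h} {T : Endofunctor C}
                {M : MonadOn C T} {S : Endofunctor C} →
                Lifting M S → Endofunctor (Kleisli M)
liftedFunctor {S = S} L = record
  { F₀ = Endofunctor.F₀ S
  ; F₁ = Lifting.F₁ L
  ; identity = Lifting.identity L
  ; homomorphism = Lifting.homomorphism L
  }

module _ {o h : Level} (C : Category o h) where
  open Category C

  HomOrder : (ℓ : Level) → Set (o ⊔ h ⊔ lsuc ℓ)
  HomOrder ℓ = ∀ {A B} → A ⇒ B → A ⇒ B → Set ℓ

  module _ {ℓ : Level} (_⊑_ : HomOrder ℓ) where

    IsAscendingChain : ∀ {A B} → (ℕ → A ⇒ B) → Set ℓ
    IsAscendingChain c = ∀ n → c n ⊑ c (suc n)

    IsSup : ∀ {A B} → (ℕ → A ⇒ B) → A ⇒ B → Set (h ⊔ ℓ)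
    IsSup {A} {B} c s = (∀ n → c n ⊑ s) × (∀ (u : A ⇒ B) → (∀ n → c n ⊑ u) → s ⊑ u)

    -- Cppo-enrichment (least element not required to be absorbing).
    record IsCppoEnriched : Set (o ⊔ h ⊔ ℓ) where
      field
        ⊑-refl : ∀ {A B} {f : A ⇒ B} → f ⊑ f
        ⊑-trans : ∀ {A B} {f g k : A ⇒ B} → f ⊑ g → g ⊑ k → f ⊑ k
        ⊑-antisym : ∀ {A B} {f g : A ⇒ B} → f ⊑ g → g ⊑ f → f ≡ g
        least : ∀ A B → Σ (A ⇒ B) (λ b → ∀ (f : A ⇒ B) → b ⊑ f)
        sup : ∀ {A B} (c : ℕ → A ⇒ B) → IsAscendingChain c → Σ (A ⇒ B) (IsSup c)
        ∘-continuousˡ : ∀ {A B D} (g : B ⇒ D) (c : ℕ → A ⇒ B) (s : A ⇒ B) →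
                        IsAscendingChain c → IsSup c s →
                        IsSup (λ n → g ∘ c n) (g ∘ s)
        ∘-continuousʳ : ∀ {A B D} (f : A ⇒ B) (c : ℕ → B ⇒ D) (s : B ⇒ D) →
                        IsAscendingChain c → IsSup c s →
                        IsSup (λ n → c n ∘ f) (s ∘ f)

IsLocallyContinuous : ∀ {o h ℓ : Level} (C : Category o h) (_⊑_ : HomOrder C ℓ) →
                      Endofunctor C → Set (o ⊔ h ⊔ ℓ)
IsLocallyContinuous C _⊑_ F =
  ∀ {A B} (c : ℕ → A ⇒ B) (s : A ⇒ B) →
  IsAscendingChain C _⊑_ c → IsSup C _⊑_ c s →
  IsSup C _⊑_ (λ n → F₁ (c n)) (F₁ s)
  where open Category C
        open Endofunctor F

-- The hom-sets of Kl(S̄) are hom-sets of Kl(T), so order, least elements and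
-- suprema are inherited unchanged.  Kleisli composition g ∗ f = m · S̄ g · f is
-- continuous in f because composition in Kl(T) is, and continuous in g because
-- S̄ is locally continuous.  The chains arising on the way stay ascending since
-- continuous maps are monotone: a ⊑ b makes b the supremum of a, b, b, …
module Submission where

open import Level using (Level; _⊔_)
open import Data.Nat using (ℕ; zero; suc)
open import Data.Product using (_,_; proj₁)
open import Defs

module _ {o h ℓ : Level} {C : Category o h} {_⊑_ : HomOrder C ℓ}
         (E : IsCppoEnriched C _⊑_) where
  open Category C
  open IsCppoEnriched E

  PreservesSups : ∀ {A B A′ B′} → (A ⇒ B → A′ ⇒ B′) → Set (h ⊔ ℓ)
  PreservesSups φ = ∀ c s → IsAscendingChain C _⊑_ c → IsSup C _⊑_ c s →
                    IsSup C _⊑_ (λ n → φ (c n)) (φ s)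

  private
    step : ∀ {A B} → A ⇒ B → A ⇒ B → ℕ → A ⇒ B
    step a b zero    = a
    step a b (suc _) = b

    step-ascending : ∀ {A B} {a b : A ⇒ B} → a ⊑ b → IsAscendingChain C _⊑_ (step a b)
    step-ascending a⊑b zero    = a⊑b
    step-ascending a⊑b (suc _) = ⊑-refl

    step-sup : ∀ {A B} {a b : A ⇒ B} → a ⊑ b → IsSup C _⊑_ (step a b) b
    step-sup a⊑b = (λ { zero → a⊑b ; (suc _) → ⊑-refl }) , (λ _ bound → bound 1)

  preservesSups⇒monotone : ∀ {A B A′ B′} {φ : A ⇒ B → A′ ⇒ B′} → PreservesSups φ →
                           ∀ {a b} → a ⊑ b → φ a ⊑ φ b
  preservesSups⇒monotone preserves a⊑b =
    proj₁ (preserves _ _ (step-ascending a⊑b) (step-sup a⊑b)) 0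

  ∘-monoˡ : ∀ {A B D} (g : B ⇒ D) {a b : A ⇒ B} → a ⊑ b → (g ∘ a) ⊑ (g ∘ b)
  ∘-monoˡ g = preservesSups⇒monotone (∘-continuousˡ g)

  ∘-monoʳ : ∀ {A B D} (f : A ⇒ B) {a b : B ⇒ D} → a ⊑ b → (a ∘ f) ⊑ (b ∘ f)
  ∘-monoʳ f = preservesSups⇒monotone (∘-continuousʳ f)

  Kleisli-isCppoEnriched : ∀ {F : Endofunctor C} (N : MonadOn C F) →
                           IsLocallyContinuous C _⊑_ F →
                           IsCppoEnriched (Kleisli N)
                             (λ {X} {Y} f g → _⊑_ {X} {Endofunctor.F₀ F Y} f g)
  Kleisli-isCppoEnriched {F} N F-continuous = record
    { ⊑-refl        = ⊑-refl
    ; ⊑-trans       = ⊑-trans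
    ; ⊑-antisym     = ⊑-antisym
    ; least         = λ A B → least A (F₀ B)
    ; sup           = sup
    ; ∘-continuousˡ = postcomposition-continuous
    ; ∘-continuousʳ = precomposition-continuous
    }
    where
    open Endofunctor F
    open MonadOn N using (μ)

    F-monotone : ∀ {A B} {a b : A ⇒ B} → a ⊑ b → F₁ a ⊑ F₁ b
    F-monotone = preservesSups⇒monotone F-continuous

    postcomposition-continuous : ∀ {A B D} (g : B ⇒ F₀ D) →
                                 PreservesSups {A} (λ f → μ D ∘ (F₁ g ∘ f))
    postcomposition-continuous {D = D} g c s ascending isSup =
      ∘-continuousˡ (μ D) _ _ (λ n → ∘-monoˡ (F₁ g) (ascending n))
        (∘-continuousˡ (F₁ g) c s ascending isSup)

    precomposition-continuous : ∀ {A B D} (f : A ⇒ F₀ B) →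
                                PreservesSups {B} {F₀ D} (λ g → μ D ∘ (F₁ g ∘ f))
    precomposition-continuous {D = D} f c s ascending isSup =
      ∘-continuousˡ (μ D) _ _ (λ n → ∘-monoʳ f (F-monotone (ascending n)))
        (∘-continuousʳ f _ _ (λ n → F-monotone (ascending n))
          (F-continuous c s ascending isSup))

theorem1 : ∀ {o h ℓ : Level} (C : Category o h) (T : Endofunctor C) (M : MonadOn C T)
    (S : Endofunctor C) (L : Lifting M S)
    (Mbar : MonadOn (Kleisli M) (liftedFunctor L))
    (_⊑_ : HomOrder (Kleisli M) ℓ) →
    IsCppoEnriched (Kleisli M) _⊑_ →
    IsLocallyContinuous (Kleisli M) _⊑_ (liftedFunctor L) →
    IsCppoEnriched (Kleisli Mbar)
    (λ {X} {Y} f g → _⊑_ {X} {Endofunctor.F₀ S Y} f g)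
theorem1 C T M S L Mbar _⊑_ KlT-cppo S̄-continuous =
  Kleisli-isCppoEnriched KlT-cppo Mbar S̄-continuous
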